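{- Let $\mathbf{O}$ be an appropriate class of operators, and let $\mathcal{F}$ be the class of all $\mathbf{O}$-representable functions. Then all $\mathcal{F}$-substitutional operators belong to $\mathbf{O}$.
   Context: $\mathbb{T}_m$ is the set of total functions $\mathbb{N}^m\to\mathbb{N}$ and $\mathbb{T}=\bigcup_m\mathbb{T}_m$; a $k$-ary operator is a map $\mathbb{T}_1^k\to\mathbb{T}_1$; $\check{c}\in\mathbb{T}_1$ is the constant function with value $c$. A class $\mathbf{O}$ of operators is appropriate if: (1) for all $k$ and $i\le k$ the operator $(f_1,\ldots,f_k)\mapsto f_i$ is in $\mathbf{O}$; (2) the operator $F(f_1,f_2)(n)=f_1(f_2(n))$ is in $\mathbf{O}$; (3) if $F$ is $k$-ary in $\mathbf{O}$ and $G_1,\ldots,G_k$ are $l$-ary in $\mathbf{O}$, then $H(g_1,\ldots,g_l)=F(G_1(g_1,\ldots,g_l),\ldots,G_k(g_1,\ldots,g_l))$ is in $\mathbf{O}$; (4) if $F$ is $(k+1)$-ary in $\mathbf{O}$, then $G(f_1,\ldots,f_k)(n)=F(f_1,\ldots,f_k,\check{n})(n)$ is in $\mathbf{O}$. For $f:\mathbb{N}^r\to\mathbb{N}$, $\mathring{f}(f_1,\ldots,f_r)(n)=f(f_1(n),\ldots,f_r(n))$; $f$ is $\mathbf{O}$-representable if $\mathring{f}\in\mathbf{O}$. For $\mathcal{F}\subseteq\mathbb{T}$ and $k,m\in\mathbb{N}$, the $\mathcal{F}$-substitutional mappings of $\mathbb{T}_1^k$ into $\mathbb{T}_m$ are defined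 inductively: (i) for any $m$-argument projection function $h$, $(f_1,\ldots,f_k)\mapsto h$ is $\mathcal{F}$-substitutional; (ii) if $F_0$ is $\mathcal{F}$-substitutional and $i\in\{1,\ldots,k\}$, then $F(f_1,\ldots,f_k)(n_1,\ldots,n_m)=f_i(F_0(f_1,\ldots,f_k)(n_1,\ldots,n_m))$ is $\mathcal{F}$-substitutional; (iii) if $r\in\mathbb{N}$, $f\in\mathcal{F}$ is $r$-argument and $F_1,\ldots,F_r$ are $\mathcal{F}$-substitutional, then $F(\bar f)(\bar n)=f(F_1(\bar f)(\bar n),\ldots,F_r(\bar f)(\bar n))$ is $\mathcal{F}$-substitutional. The $\mathcal{F}$-substitutional mappings of $\mathbb{T}_1^k$ into $\mathbb{T}_1$ are the $k$-ary $\mathcal{F}$-substitutional operators. -}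

module Defs where

open import Data.Nat using (ℕ; suc)
open import Data.Fin using (Fin; fromℕ)
import Data.Fin as Fin
open import Data.Vec.Functional using (insertAt)
open import Relation.Binary.PropositionalEquality using (_≡_)

𝕋 : ℕ → Set
𝕋 m = (Fin m → ℕ) → ℕ

-- functions of one variable (the elements of 𝕋_1, written as ℕ → ℕ)
𝕋₁ : Set
𝕋₁ = ℕ → ℕ

Op : ℕ → Set
Op k = (Fin k → 𝕋₁) → 𝕋₁

const : ℕ → 𝕋₁
const c _ = c

OpClass : Set₁
OpClass = (k : ℕ) → Op k → Set

_≈Op_ : ∀ {k} → Op k → Op k → Set
F ≈Op G = ∀ fs n → F fs n ≡ G fs n

snoc : ∀ {k} → (Fin k → 𝕋₁) → 𝕋₁ → Fin (suc k) → 𝕋₁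
snoc {k} fs g = insertAt fs (fromℕ k) g

record Appropriate (O : OpClass) : Set where
  field
    -- O is a class of operators-as-functions (membership respects equality of functions)
    ext  : ∀ {k} {F G : Op k} → F ≈Op G → O k F → O k G
    proj : ∀ k (i : Fin k) → O k (λ fs → fs i)
    comp : O 2 (λ fs n → fs Fin.zero (fs (Fin.suc Fin.zero) n))
    subst : ∀ k l (F : Op k) (G : Fin k → Op l) → O k F → (∀ i → O l (G i))
          → O l (λ gs → F (λ i → G i gs))
    diag : ∀ k (F : Op (suc k)) → O (suc k) F
         → O k (λ fs n → F (snoc fs (const n)) n)

ring : ∀ {r} → 𝕋 r → Op r
ring f fs n = f (λ i → fs i n)

Representable : OpClass → (r : ℕ) → 𝕋 r → Set
Representable O r f = O r (ring f)

FunClass : Set₁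
FunClass = (r : ℕ) → 𝕋 r → Set

data Substitutional (𝓕 : FunClass) (k : ℕ) : (m : ℕ) → ((Fin k → 𝕋₁) → 𝕋 m) → Set where
  sproj : ∀ {m} (j : Fin m) → Substitutional 𝓕 k m (λ fs ns → ns j)
  sapp  : ∀ {m} {F₀ : (Fin k → 𝕋₁) → 𝕋 m} → Substitutional 𝓕 k m F₀ → (i : Fin k)
        → Substitutional 𝓕 k m (λ fs ns → fs i (F₀ fs ns))
  sfun  : ∀ {m} (r : ℕ) (f : 𝕋 r) → 𝓕 r f
        → {Fs : Fin r → (Fin k → 𝕋₁) → 𝕋 m} → (∀ j → Substitutional 𝓕 k m (Fs j))
        → Substitutional 𝓕 k m (λ fs ns → f (λ j → Fs j fs ns))

-- a mapping 𝕋_1^k → 𝕋_1 (with 𝕋_1 as (Fin 1 → ℕ) → ℕ) seen as an operator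
toOp : ∀ {k} → ((Fin k → 𝕋₁) → 𝕋 1) → Op k
toOp F fs n = F fs (λ _ → n)

module Submission where

-- The proof is an induction on the derivation of substitutionality, with
-- one closure property of an appropriate class O for each of the three
-- formation rules:
--   (i)   the identity operator  fs ↦ id  is in O: apply the diagonal
--         rule (4) to the projection onto the extra argument, which then
--         returns the constant function č with value n at the point n;
--   (ii)  O is closed under pointwise composition  fs ↦ G fs ∘ H fs,
--         obtained by substituting G and H into the composition operator (2)
--         via rule (3); case (ii) composes the projection onto fs i with the
--         operator given by the induction hypothesis;
--   (iii) for f representable, the operator f̊ is in O, and substituting the
--         induction hypotheses into f̊ via rule (3) is exactly case (iii).

open import Defs
open import Data.Nat using (ℕ; suc)
open import Data.Fin using (Fin; fromℕ)
open import Data.Vec.Functional using ([]; _∷_)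
open import Data.Vec.Functional.Properties using (insertAt-lookup)
open import Relation.Binary.PropositionalEquality using (cong)

module _ {O : OpClass} (appropriate : Appropriate O) where
  open Appropriate appropriate

  identityOp : ∀ k → O k (λ fs n → n)
  identityOp k = ext lastArgument (diag k (λ gs → gs (fromℕ k)) (proj (suc k) (fromℕ k)))
    where
    lastArgument : (λ fs n → snoc fs (const n) (fromℕ k) n) ≈Op (λ fs n → n)
    lastArgument fs n = cong (λ g → g n) (insertAt-lookup fs (fromℕ k) (const n))

  composeOp : ∀ {k} {G H : Op k} → O k G → O k H → O k (λ fs n → G fs (H fs n))
  composeOp {k} {G} {H} G∈O H∈O =
    subst 2 k _ (λ j fs → (G fs ∷ H fs ∷ []) j) comp
          (λ { Fin.zero → G∈O ; (Fin.suc Fin.zero) → H∈O })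

  substitutionalInO : ∀ {k} {F : (Fin k → 𝕋₁) → 𝕋 1}
                    → Substitutional (Representable O) k 1 F → O k (toOp F)
  substitutionalInO {k} (sproj _)              = identityOp k
  substitutionalInO {k} (sapp S i)             = composeOp (proj k i) (substitutionalInO S)
  substitutionalInO {k} (sfun r f f̊∈O {Fs} Ss) =
    subst r k (ring f) (λ j → toOp (Fs j)) f̊∈O (λ j → substitutionalInO (Ss j))

corollary3 : (O : OpClass) → Appropriate O
    → (k : ℕ) (F : (Fin k → 𝕋₁) → 𝕋 1)
    → Substitutional (Representable O) k 1 F
    → O k (toOp F)
corollary3 O appropriate k F S = substitutionalInO appropriate S
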